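{- Let $n,m,h,r,\lambda$ be positive integers with $n>m>h\ge2$. Suppose a partial $r$-factorization of $\mathcal G:=\lambda K_m^h$ (with respect to $n$) can be extended to a connected $r$-factorization of $\lambda K_n^h$. Then: (N1) the triple $(n,r,\lambda)$ is $h$-admissible; (N2) no component of any color class of $\mathcal G$ is $r$-regular; (N3) for all $j\in[k]$, where $k:=\frac{\lambda}{r}\binom{n-1}{h-1}$, $$rm-rn+\frac{rn}{h}\le |E(\mathcal G(j))|\le \frac{rn}{h}-\frac{n-m+c(\mathcal G(j))-1}{h-1}.$$
   Context: $\lambda K_n^h$: the hypergraph on $n$ vertices in which every $h$-subset of vertices is an edge of multiplicity $\lambda$ (no other edges); $\lambda K_m^h$ is regarded as its sub-hypergraph induced on a fixed set of $m$ of the $n$ vertices. An $r$-factor of a hypergraph is a spanning sub-hypergraph in which every vertex has degree $r$; an $r$-factorization is a partition of the edges into $r$-factors, i.e. an edge-coloring in which each color class (spanning sub-hypergraph of the edges of that color) is an $r$-factor; it is connected if every color class is connected. With $k=\lambda\binom{n-1}{h-1}/r$, a partial $r$-factorization of $\lambda K_m^h$ is a coloring of its edges with colors from $[k]$ such that every vertex has degree at most $r$ in each color class (color classes may be empty); $\mathcal G(j)$ denotes color class $j$, a spanning sub-hypergraph on all $m$ vertices, and $c(\cdot)$ counts connected components (isolated vertices included). It extends to a connected $r$-factorization of $\lambda K_n^h$ if there is a coloring of all edges of $\lambda K_n^h$ with colors from $[k]$, agreeing with the given coloring on the edges of $\lambda K_m^h$, in which every color class is a connected $r$-factor. $(n,r,\lambda)$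 is $h$-admissible if $h\mid rn$ and $r\mid\lambda\binom{n-1}{h-1}$. -}

module Defs where

open import Data.Nat using (ℕ; zero; suc; _+_; _*_; _∸_; _≤_; _<_; _<?_; _≟_)
open import Data.Bool using (Bool; true; false)
open import Data.Fin using (Fin; toℕ; fromℕ<)
open import Data.Fin.Subset using (Subset; _∈_; ∣_∣)
open import Data.Vec using (Vec; []; _∷_; lookup; tabulate)
open import Data.List using (List; []; _∷_; _++_; map; concatMap; filter; length; sum; allFin)
open import Data.List.Relation.Unary.Any using (Any)
open import Data.Product using (Σ; _×_; _,_)
open import Relation.Binary.PropositionalEquality using (_≡_)
open import Relation.Binary.Construct.Closure.ReflexiveTransitive using (Star)
open import Relation.Nullary using (yes; no)
open import Function using (Surjective)
import Data.Fin as F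

-- Generic finite hypergraphs: vertex set Fin v, edges a list (multiset)
-- of subsets of Fin v.

allSubsets : (n : ℕ) → List (Subset n)
allSubsets zero = [] ∷ []
allSubsets (suc n) = map (true ∷_) (allSubsets n) ++ map (false ∷_) (allSubsets n)

completeEdges : (n h λ' : ℕ) → List (Subset n × Fin λ')
completeEdges n h λ' =
  concatMap (λ S → map (λ i → (S , i)) (allFin λ'))
            (filter (λ S → ∣ S ∣ ≟ h) (allSubsets n))

-- color class j of a coloring of the edges of λK_n^h (colors in Fin k);
-- the coloring is a function on (subset, copy index) pairs, only its
-- values on h-subsets are relevant.
colorClass : ∀ {k} (n h λ' : ℕ) → (Subset n → Fin λ' → Fin k) → Fin k → List (Subset n)
colorClass n h λ' col j =
  map (λ e → Data.Product.proj₁ e)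
      (filter (λ e → col (Data.Product.proj₁ e) (Data.Product.proj₂ e) F.≟ j)
              (completeEdges n h λ'))

degree : ∀ {v} → Fin v → List (Subset v) → ℕ
degree x E = length (filter (λ S → Data.Bool._≟_ (lookup S x) true) E)

Adj : ∀ {v} → List (Subset v) → Fin v → Fin v → Set
Adj E x y = Any (λ S → x ∈ S × y ∈ S) E

Linked : ∀ {v} → List (Subset v) → Fin v → Fin v → Set
Linked E = Star (Adj E)

IsConnected : ∀ {v} → List (Subset v) → Set
IsConnected {v} E = (x y : Fin v) → Linked E x y

IsRFactor : ∀ {v} → ℕ → List (Subset v) → Set
IsRFactor {v} r E = (x : Fin v) → degree x E ≡ r

-- the hypergraph (Fin v , E) has exactly c connected components
-- (isolated vertices included): there is a surjection from the vertices
-- onto Fin c identifying exactly the vertices in the same component.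
NumComponents : ∀ {v} → List (Subset v) → ℕ → Set
NumComponents {v} E c =
  Σ (Fin v → Fin c) λ f →
    Surjective _≡_ _≡_ f ×
    ((x y : Fin v) → (f x ≡ f y → Linked E x y) × (Linked E x y → f x ≡ f y))

-- the component of x is r-regular: every vertex of it has degree r
-- (a component contains every edge meeting it, so degrees agree)
ComponentRRegular : ∀ {v} → ℕ → List (Subset v) → Fin v → Set
ComponentRRegular {v} r E x = (y : Fin v) → Linked E x y → degree y E ≡ r

embed : ∀ {m n} → Subset m → Subset n
embed {m} {n} S = tabulate f
  where
  f : Fin n → Bool
  f x with toℕ x <? m
  ... | yes p = lookup S (fromℕ< p)
  ... | no _ = false

-- Let F be a colour class of the extension on n = m + d vertices and G its restriction to
-- the first m vertices: F consists of G, padded with d isolated vertices, and of the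
-- crossing edges X, each of which contains one of the d new vertices.
-- (N1) Every vertex of F has degree r and every edge has h vertices, so h |F| = r n;
-- summing the degree of one vertex over all k colours gives k r = λ C(n-1, h-1).
-- (N2) The vertices of an r-regular component of G have no degree left for crossing
-- edges, so that component is also a component of the connected F; impossible as d ≥ 1.
-- (N3) The d new vertices have degree r and meet every crossing edge, so |X| ≤ d r, and
-- h (|G| + |X|) = r n gives the lower bound. Padded G has c + d components and adding an
-- edge of h vertices merges at most h of them into one, so connectivity of F forces
-- c + d ≤ 1 + (h-1) |X|, which gives the upper bound.
module Submission where

open import Level using (Level)
open import Function using (_∘_; id; _⇔_; Equivalence; mk⇔; Surjective)
open import Relation.Binary.PropositionalEquality hiding ([_])
open import Relation.Nullary using (¬_; yes; no; does; contradiction)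
open import Relation.Nullary.Decidable using (¬?; _×-dec_)
open import Relation.Unary using (Pred; Decidable)
open import Relation.Binary.Construct.Closure.ReflexiveTransitive as Star using (ε; _◅_; _◅◅_)
open import Data.Bool using (Bool; true; false; T; T?) renaming (_≟_ to _≟ᵇ_)
open import Data.Product as Product using (∃; _×_; _,_; proj₁; proj₂; map₁)
open import Data.Sum using (_⊎_; inj₁; inj₂; [_,_]′)
open import Data.Nat using (ℕ; zero; suc; _+_; _*_; _∸_; _≤_; _<_; z≤n; s≤s; NonZero; _≟_; _<?_; _/_)
open import Data.Nat.Properties
open import Data.Nat.Divisibility using (_∣_; divides)
open import Data.Nat.Combinatorics using (_C_; nCk+nC[k+1]≡[n+1]C[k+1])
open import Data.Nat.Tactic.RingSolver using (solve-∀)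
open import Algebra.Properties.CommutativeMonoid.Sum +-0-commutativeMonoid
  using (sum; sum-syntax; sum-cong-≗; ∑-distrib-+)
open import Data.Fin as F using (Fin; toℕ; _↑ˡ_; _↑ʳ_; splitAt)
import Data.Fin.Properties as Finₚ
open import Data.Fin.Subset using (Subset; ∣_∣; _∈_; _-_) renaming (⊥ to ∅)
open import Data.Fin.Subset.Properties using (_∈?_; x∈p⇒∣p-x∣<∣p∣; x∈p∧x≢y⇒x∈p-y; ∣⊥∣≡0)
open import Data.Vec using ([]; _∷_; lookup) renaming (_++_ to _++ᵛ_)
open import Data.Vec.Properties
  using ([]=⇒lookup; lookup⇒[]=; lookup∘tabulate; tabulate∘lookup; tabulate-cong;
         lookup-++-<; lookup-++-≥; lookup-++ˡ; lookup-++ʳ; lookup-replicate)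
open import Data.Vec.Functional using (Vector)
open import Data.List using (List; []; _∷_; _++_; [_]; map; filter; filterᵇ; length; concatMap; allFin)
open import Data.List.Properties
  using (filter-++; filter-accept; filter-reject; filter-some; filter-none; filter-all; filter-≐;
         length-++; length-map; length-tabulate; map-++; map-∘; ++-identityʳ; ++-assoc)
open import Data.List.Relation.Unary.All as All using (All; []; _∷_)
import Data.List.Relation.Unary.All.Properties as AllP
open import Data.List.Relation.Unary.Any as Any using (Any; here)
import Data.List.Relation.Unary.Any.Properties as AnyP
open import Data.List.Relation.Unary.AllPairs as AllPairs using (AllPairs; []; _∷_)
import Data.List.Relation.Unary.AllPairs.Properties as AllPairsP
open import Data.List.Relation.Unary.Unique.Propositional.Properties using (allFin⁺)
open import Data.List.Membership.Propositional using (find; lose)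
open import Data.List.Membership.Propositional.Properties using (∈-filter⁺)
open import Defs

private
  variable
    a p q : Level
    A B : Set a

∑-const : ∀ n c → ∑[ i < n ] c ≡ n * c
∑-const zero c = refl
∑-const (suc n) c = cong (c +_) (∑-const n c)

∑-mono : ∀ {n} {f g : Vector ℕ n} → (∀ i → f i ≤ g i) → sum f ≤ sum g
∑-mono {zero} f≤g = z≤n
∑-mono {suc n} f≤g = +-mono-≤ (f≤g F.zero) (∑-mono (f≤g ∘ F.suc))

term≤∑ : ∀ {n} (f : Vector ℕ n) i → f i ≤ sum f
term≤∑ f F.zero = m≤m+n _ _
term≤∑ f (F.suc i) = ≤-trans (term≤∑ (f ∘ F.suc) i) (m≤n+m _ _)

∑-vanishing : ∀ {n} (f : Vector ℕ n) → (∀ i → f i ≡ 0) → sum f ≡ 0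
∑-vanishing {n} f f≡0 = trans (sum-cong-≗ {x = f} {y = λ _ → 0} f≡0) (trans (∑-const n 0) (*-zeroʳ n))

∑-supported-at : ∀ {n} (f : Vector ℕ n) i → (∀ j → i ≢ j → f j ≡ 0) → sum f ≡ f i
∑-supported-at f F.zero f≡0 =
  trans (cong (f F.zero +_) (∑-vanishing (f ∘ F.suc) (λ j → f≡0 (F.suc j) λ ()))) (+-identityʳ _)
∑-supported-at f (F.suc i) f≡0 rewrite f≡0 F.zero (λ ()) =
  ∑-supported-at (f ∘ F.suc) i (λ j i≢j → f≡0 (F.suc j) (i≢j ∘ Finₚ.suc-injective))

module _ {P : Pred A p} {Q : Pred A q} (P? : Decidable P) (Q? : Decidable Q) where

  filter-comm : ∀ xs → filter P? (filter Q? xs) ≡ filter Q? (filter P? xs)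
  filter-comm [] = refl
  filter-comm (x ∷ xs) with P? x | Q? x
  ... | yes px | yes qx =
    trans (filter-accept P? px) (trans (cong (x ∷_) (filter-comm xs)) (sym (filter-accept Q? qx)))
  ... | yes _ | no ¬qx = trans (filter-comm xs) (sym (filter-reject Q? ¬qx))
  ... | no ¬px | yes _ = trans (filter-reject P? ¬px) (filter-comm xs)
  ... | no _ | no _ = filter-comm xs

  filter-cong-All : ∀ {xs} → All (λ x → P x ⇔ Q x) xs → filter P? xs ≡ filter Q? xs
  filter-cong-All [] = refl
  filter-cong-All {x ∷ xs} (P⇔Q ∷ rest) with P? x | Q? x
  ... | yes _ | yes _ = cong (x ∷_) (filter-cong-All rest)
  ... | no _ | no _ = filter-cong-All rest
  ... | yes px | no ¬qx = contradiction (Equivalence.to P⇔Q px) ¬qx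
  ... | no ¬px | yes qx = contradiction (Equivalence.from P⇔Q qx) ¬px


module _ {P : Pred B p} (P? : Decidable P) where

  filter-map-comm : ∀ (f : A → B) xs → filter P? (map f xs) ≡ map f (filter (P? ∘ f) xs)
  filter-map-comm f [] = refl
  filter-map-comm f (x ∷ xs) with does (P? (f x))
  ... | true = cong (f x ∷_) (filter-map-comm f xs)
  ... | false = filter-map-comm f xs

  length-filter-split : ∀ (xs : List B) → length xs ≡ length (filter P? xs) + length (filter (¬? ∘ P?) xs)
  length-filter-split [] = refl
  length-filter-split (x ∷ xs) with P? x
  ... | yes _ = cong suc (length-filter-split xs)
  ... | no _ = trans (cong suc (length-filter-split xs)) (sym (+-suc _ _))

AllPairs-mapWith-All : ∀ {P : Pred A p} {R S : A → A → Set q} {xs} →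
  (∀ {x y} → P x → R x y → S x y) → All P xs → AllPairs R xs → AllPairs S xs
AllPairs-mapWith-All f [] [] = []
AllPairs-mapWith-All f (px ∷ pxs) (rxs ∷ rs) = All.map (f px) rxs ∷ AllPairs-mapWith-All f pxs rs

Any-filter-split : ∀ {P : Pred A p} {Q : Pred A q} (P? : Decidable P) {xs} →
  Any Q xs → Any Q (filter P? xs) ⊎ Any Q (filter (¬? ∘ P?) xs)
Any-filter-split P? any with find any
... | x , x∈xs , qx with P? x
...   | yes px = inj₁ (lose (∈-filter⁺ P? x∈xs px) qx)
...   | no ¬px = inj₂ (lose (∈-filter⁺ (¬? ∘ P?) x∈xs ¬px) qx)

linked-filter-split : ∀ {v} {P : Pred (Subset v) p} (P? : Decidable P) {E x y} →
  Linked E x y → Linked (filter P? E ++ filter (¬? ∘ P?) E) x y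
linked-filter-split P? {E} = Star.map λ adj → [ AnyP.++⁺ˡ , AnyP.++⁺ʳ (filter P? E) ]′ (Any-filter-split P? adj)

bit : Bool → ℕ
bit true = 1
bit false = 0

∑-bit≡∣∣ : ∀ {v} (S : Subset v) → ∑[ x < v ] bit (lookup S x) ≡ ∣ S ∣
∑-bit≡∣∣ [] = refl
∑-bit≡∣∣ (true ∷ S) = cong suc (∑-bit≡∣∣ S)
∑-bit≡∣∣ (false ∷ S) = ∑-bit≡∣∣ S

module _ {v : ℕ} where

  degree-∷ : ∀ (x : Fin v) S E → degree x (S ∷ E) ≡ bit (lookup S x) + degree x E
  degree-∷ x S E with lookup S x
  ... | true = refl
  ... | false = refl

  degree-++ : ∀ (x : Fin v) E E′ → degree x (E ++ E′) ≡ degree x E + degree x E′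
  degree-++ x E E′ = trans (cong length (filter-++ _ E E′)) (length-++ (filter _ E))

  degree-filter-split : ∀ {P : Pred (Subset v) p} (P? : Decidable P) (x : Fin v) E →
    degree x E ≡ degree x (filter P? E) + degree x (filter (¬? ∘ P?) E)
  degree-filter-split P? x E = trans (length-filter-split P? (filter x∈? E))
    (cong₂ (λ L L′ → length L + length L′) (filter-comm P? x∈? E) (filter-comm (¬? ∘ P?) x∈? E))
    where
    x∈? : Decidable (λ (S : Subset v) → lookup S x ≡ true)
    x∈? S = lookup S x ≟ᵇ true

  degree-pos : ∀ {x : Fin v} {E} → Any (x ∈_) E → 0 < degree x E
  degree-pos = filter-some _ ∘ Any.map []=⇒lookup

  ∑-degree-uniform : ∀ h E → All (λ S → ∣ S ∣ ≡ h) E → ∑[ x < v ] degree x E ≡ h * length E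
  ∑-degree-uniform h [] [] = trans (∑-vanishing (λ (x : Fin v) → degree x []) (λ _ → refl)) (sym (*-zeroʳ h))
  ∑-degree-uniform h (S ∷ E) (∣S∣≡h ∷ sizes) = begin
    ∑[ x < v ] degree x (S ∷ E)
      ≡⟨ sum-cong-≗ {x = λ x → degree x (S ∷ E)} (λ x → degree-∷ x S E) ⟩
    ∑[ x < v ] (bit (lookup S x) + degree x E)
      ≡⟨ ∑-distrib-+ (λ x → bit (lookup S x)) (λ x → degree x E) ⟩
    ∑[ x < v ] bit (lookup S x) + ∑[ x < v ] degree x E
      ≡⟨ cong₂ _+_ (trans (∑-bit≡∣∣ S) ∣S∣≡h) (∑-degree-uniform h E sizes) ⟩
    h + h * length E
      ≡⟨ *-suc h (length E) ⟨
    h * length (S ∷ E) ∎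
    where open ≡-Reasoning

  length≤∑-degree : ∀ {d} (g : Fin d → Fin v) E → All (λ S → ∃ λ i → lookup S (g i) ≡ true) E →
    length E ≤ ∑[ i < d ] degree (g i) E
  length≤∑-degree g [] [] = z≤n
  length≤∑-degree {d} g (S ∷ E) ((i , Sgi) ∷ meets) = begin
    suc (length E)
      ≤⟨ +-mono-≤ S∋gi (length≤∑-degree g E meets) ⟩
    ∑[ i < d ] bit (lookup S (g i)) + ∑[ i < d ] degree (g i) E
      ≡⟨ ∑-distrib-+ (λ i → bit (lookup S (g i))) (λ i → degree (g i) E) ⟨
    ∑[ i < d ] (bit (lookup S (g i)) + degree (g i) E)
      ≡⟨ sum-cong-≗ {x = λ i → bit (lookup S (g i)) + degree (g i) E} (λ i → sym (degree-∷ (g i) S E)) ⟩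
    ∑[ i < d ] degree (g i) (S ∷ E) ∎
    where
    open ≤-Reasoning
    S∋gi : 1 ≤ ∑[ i < d ] bit (lookup S (g i))
    S∋gi = ≤-trans (≤-reflexive (cong bit (sym Sgi))) (term≤∑ (λ i → bit (lookup S (g i))) i)

-- Counting components

IsComponentLabelling : ∀ {v} → List (Subset v) → (Fin v → ℕ) → Set
IsComponentLabelling {v} E f = (x y : Fin v) → (f x ≡ f y → Linked E x y) × (Linked E x y → f x ≡ f y)

module _ {v : ℕ} (f : Fin v → ℕ) where

  DistinctLabels : Fin v → Fin v → Set
  DistinctLabels x y = f x ≢ f y

  Touches : Subset v → Fin v → Set
  Touches S x = ∃ λ s → s ∈ S × f x ≡ f s

  touches? : ∀ S → Decidable (Touches S)
  touches? S x = Finₚ.any? (λ s → (s ∈? S) ×-dec (f x ≟ f s))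

  distinct-touching⇒length≤∣S∣ : ∀ S X → AllPairs DistinctLabels X → All (Touches S) X → length X ≤ ∣ S ∣
  distinct-touching⇒length≤∣S∣ S [] _ _ = z≤n
  distinct-touching⇒length≤∣S∣ S (a ∷ X) (a≁X ∷ distinct) ((s , s∈S , fa≡fs) ∷ touching) =
    ≤-trans (s≤s (distinct-touching⇒length≤∣S∣ (S - s) X distinct (All.zipWith touch-S-s (a≁X , touching))))
            (x∈p⇒∣p-x∣<∣p∣ s∈S)
    where
    touch-S-s : ∀ {b} → f a ≢ f b × Touches S b → Touches (S - s) b
    touch-S-s (fa≢fb , t , t∈S , fb≡ft) =
      t , x∈p∧x≢y⇒x∈p-y t∈S (λ t≡s → fa≢fb (trans fa≡fs (sym (trans fb≡ft (cong f t≡s))))) , fb≡ft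

  -- adding the edge S merges the components it meets into one, labelled 0
  merged : Subset v → Fin v → ℕ
  merged S x with touches? S x
  ... | yes _ = 0
  ... | no _ = suc (f x)

  module _ (S : Subset v) where

    merged-touching : ∀ {x} → Touches S x → merged S x ≡ 0
    merged-touching {x} touch with touches? S x
    ... | yes _ = refl
    ... | no untouched = contradiction touch untouched

    merged-untouched : ∀ {x} → ¬ Touches S x → merged S x ≡ suc (f x)
    merged-untouched {x} untouched with touches? S x
    ... | yes touch = contradiction touch untouched
    ... | no _ = refl

    merged-cong : ∀ {x y} → f x ≡ f y → merged S x ≡ merged S y
    merged-cong {x} {y} fx≡fy with touches? S x | touches? S y
    ... | yes _ | yes _ = refl
    ... | no _ | no _ = cong suc fx≡fy
    ... | yes (s , s∈S , fx≡fs) | no untouched = contradiction (s , s∈S , trans (sym fx≡fy) fx≡fs) untouched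
    ... | no untouched | yes (s , s∈S , fy≡fs) = contradiction (s , s∈S , trans fx≡fy fy≡fs) untouched

    merged-untouched-injective : ∀ {x y} → ¬ Touches S x → merged S x ≡ merged S y → f x ≡ f y
    merged-untouched-injective {x} {y} untouched eq with touches? S y
    ... | yes _ = contradiction (trans (sym (merged-untouched untouched)) eq) λ ()
    ... | no _ = suc-injective (trans (sym (merged-untouched untouched)) eq)

    merged-labelling : ∀ {E} → IsComponentLabelling E f → IsComponentLabelling (E ++ [ S ]) (merged S)
    merged-labelling {E} lab x y = sound , Star.fold (λ a b → merged S a ≡ merged S b) (trans ∘ adjacent) refl
      where
      liftE : ∀ {a b} → Linked E a b → Linked (E ++ [ S ]) a b
      liftE = Star.map (AnyP.++⁺ˡ)

      adjacent : ∀ {a b} → Adj (E ++ [ S ]) a b → merged S a ≡ merged S b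
      adjacent {a} {b} adj with AnyP.++⁻ E adj
      ... | inj₁ adjE = merged-cong (proj₂ (lab a b) (adjE ◅ ε))
      ... | inj₂ (here (a∈S , b∈S)) = trans (merged-touching (a , a∈S , refl)) (sym (merged-touching (b , b∈S , refl)))

      sound : merged S x ≡ merged S y → Linked (E ++ [ S ]) x y
      sound with touches? S x | touches? S y
      ... | yes (s , s∈S , fx≡fs) | yes (t , t∈S , fy≡ft) = λ _ →
        liftE (proj₁ (lab x s) fx≡fs) ◅◅ (AnyP.++⁺ʳ E (here (s∈S , t∈S)) ◅ liftE (proj₁ (lab t y) (sym fy≡ft)))
      ... | no _ | no _ = liftE ∘ proj₁ (lab x y) ∘ suc-injective
      ... | yes _ | no _ = λ ()
      ... | no _ | yes _ = λ ()

length-distinctLabels≤ : ∀ {v} h′ (R E : List (Subset v)) f → IsComponentLabelling E f → IsConnected (E ++ R) →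
  All (λ S → ∣ S ∣ ≤ suc h′) R → ∀ X → AllPairs (DistinctLabels f) X → length X ≤ suc (h′ * length R)
length-distinctLabels≤ h′ [] E f lab conn _ [] _ = z≤n
length-distinctLabels≤ h′ [] E f lab conn _ (a ∷ []) _ = s≤s z≤n
length-distinctLabels≤ h′ [] E f lab conn _ (a ∷ b ∷ X) ((fa≢fb ∷ _) ∷ _) =
  contradiction (proj₂ (lab a b) (subst (λ L → Linked L a b) (++-identityʳ E) (conn a b))) fa≢fb
length-distinctLabels≤ {v} h′ (S ∷ R) E f lab conn (∣S∣≤1+h′ ∷ sizes) X distinct = begin
  length X             ≡⟨ length-filter-split (touches? f S) X ⟩
  length near + length far  ≤⟨ count near (≤-trans near≤∣S∣ ∣S∣≤1+h′) (AllP.all-filter (touches? f S) X) ⟩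
  suc (h′ * suc (length R)) ∎
  where
  open ≤-Reasoning
  near far : List (Fin v)
  near = filter (touches? f S) X
  far = filter (¬? ∘ touches? f S) X

  near≤∣S∣ : length near ≤ ∣ S ∣
  near≤∣S∣ = distinct-touching⇒length≤∣S∣ f S near (AllPairsP.filter⁺ (touches? f S) distinct)
                                                    (AllP.all-filter (touches? f S) X)

  far-untouched : All (¬_ ∘ Touches f S) far
  far-untouched = AllP.all-filter (¬? ∘ touches? f S) X

  far-distinct : AllPairs (DistinctLabels (merged f S)) far
  far-distinct = AllPairs-mapWith-All (λ untouched fx≢fy → fx≢fy ∘ merged-untouched-injective f S untouched)
                 far-untouched (AllPairsP.filter⁺ (¬? ∘ touches? f S) distinct)

  IH : ∀ Y → AllPairs (DistinctLabels (merged f S)) Y → length Y ≤ suc (h′ * length R)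
  IH = length-distinctLabels≤ h′ R (E ++ [ S ]) (merged f S) (merged-labelling f S lab)
         (λ x y → subst (λ L → Linked L x y) (sym (++-assoc E [ S ] R)) (conn x y)) sizes

  count : ∀ rest → length rest ≤ suc h′ → All (Touches f S) rest → length rest + length far ≤ suc (h′ * suc (length R))
  count [] _ _ = ≤-trans (IH far far-distinct) (s≤s (*-monoʳ-≤ h′ (n≤1+n _)))
  count (a ∷ rest) (s≤s rest≤h′) (a-touches ∷ _) = begin
    suc (length rest + length far)     ≡⟨ +-suc (length rest) (length far) ⟨
    length rest + suc (length far)     ≤⟨ +-mono-≤ rest≤h′ (IH (a ∷ far) (a-apart ∷ far-distinct)) ⟩
    h′ + suc (h′ * length R)       ≡⟨ +-suc h′ (h′ * length R) ⟩
    suc (h′ + h′ * length R)       ≡⟨ cong suc (*-suc h′ (length R)) ⟨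
    suc (h′ * suc (length R))      ∎
    where
    a-apart : All (DistinctLabels (merged f S) a) far
    a-apart = All.map (λ untouched eq → 0≢1+n (trans (sym (merged-touching f S a-touches))
                                                     (trans eq (merged-untouched f S untouched))))
                      far-untouched

numComponents≤ : ∀ {v} h′ (E R : List (Subset v)) {c} → NumComponents E c → IsConnected (E ++ R) →
  All (λ S → ∣ S ∣ ≤ suc h′) R → c ≤ suc (h′ * length R)
numComponents≤ {v} h′ E R {c} (f , surjective , linked⇔) conn sizes =
  subst (_≤ suc (h′ * length R)) length-reps
    (length-distinctLabels≤ h′ R E (toℕ ∘ f) labelling conn sizes reps reps-distinct)
  where
  labelling : IsComponentLabelling E (toℕ ∘ f)
  labelling x y = proj₁ (linked⇔ x y) ∘ Finₚ.toℕ-injective , cong toℕ ∘ proj₂ (linked⇔ x y)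

  rep : Fin c → Fin v
  rep l = proj₁ (surjective l)

  reps : List (Fin v)
  reps = map rep (allFin c)

  length-reps : length reps ≡ c
  length-reps = trans (length-map rep (allFin c)) (length-tabulate {n = c} id)

  reps-distinct : AllPairs (DistinctLabels (toℕ ∘ f)) reps
  reps-distinct = AllPairsP.map⁺ (AllPairs.map
    (λ {l} {l′} l≢l′ eq → l≢l′ (trans (sym (proj₂ (surjective l) refl))
                                  (trans (Finₚ.toℕ-injective eq) (proj₂ (surjective l′) refl))))
    (allFin⁺ c))

ofSize? : ∀ {n} k → Decidable (λ (S : Subset n) → ∣ S ∣ ≡ k)
ofSize? k S = ∣ S ∣ ≟ k

module _ {n : ℕ} (𝒮 : List (Subset n)) where

  filter-ofSize-true∷ : ∀ k → filter (ofSize? (suc k)) (map (true ∷_) 𝒮) ≡ map (true ∷_) (filter (ofSize? k) 𝒮)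
  filter-ofSize-true∷ k = trans (filter-map-comm (ofSize? (suc k)) (true ∷_) 𝒮) (cong (map (true ∷_))
    (filter-≐ (ofSize? (suc k) ∘ (true ∷_)) (ofSize? k) (suc-injective , cong suc) 𝒮))

  filter-ofSize0-true∷ : filter (ofSize? 0) (map (true ∷_) 𝒮) ≡ []
  filter-ofSize0-true∷ = filter-none (ofSize? 0) (AllP.map⁺ (All.universal (λ _ ()) 𝒮))

  filter-ofSize-false∷ : ∀ k → filter (ofSize? k) (map (false ∷_) 𝒮) ≡ map (false ∷_) (filter (ofSize? k) 𝒮)
  filter-ofSize-false∷ k = filter-map-comm (ofSize? k) (false ∷_) 𝒮

length-subsetsOfSize : ∀ n k → length (filter (ofSize? k) (allSubsets n)) ≡ n C k
length-subsetsOfSize zero zero = refl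
length-subsetsOfSize zero (suc k) = refl
length-subsetsOfSize (suc n) k = begin
  length (filter (ofSize? k) (map (true ∷_) 𝒮 ++ map (false ∷_) 𝒮))
    ≡⟨ cong length (filter-++ (ofSize? k) (map (true ∷_) 𝒮) (map (false ∷_) 𝒮)) ⟩
  length (filter (ofSize? k) (map (true ∷_) 𝒮) ++ filter (ofSize? k) (map (false ∷_) 𝒮))
    ≡⟨ length-++ (filter (ofSize? k) (map (true ∷_) 𝒮)) ⟩
  length (filter (ofSize? k) (map (true ∷_) 𝒮)) + length (filter (ofSize? k) (map (false ∷_) 𝒮))
    ≡⟨ cong (length (filter (ofSize? k) (map (true ∷_) 𝒮)) +_)
            (trans (cong length (filter-ofSize-false∷ 𝒮 k)) (length-map (false ∷_) (filter (ofSize? k) 𝒮))) ⟩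
  length (filter (ofSize? k) (map (true ∷_) 𝒮)) + length (filter (ofSize? k) 𝒮)
    ≡⟨ pascal k ⟩
  suc n C k ∎
  where
  open ≡-Reasoning
  𝒮 : List (Subset n)
  𝒮 = allSubsets n
  pascal : ∀ k → length (filter (ofSize? k) (map (true ∷_) 𝒮)) + length (filter (ofSize? k) 𝒮) ≡ suc n C k
  pascal zero = trans (cong (λ L → length L + length (filter (ofSize? 0) 𝒮)) (filter-ofSize0-true∷ 𝒮))
                      (length-subsetsOfSize n 0)
  pascal (suc k) = begin
    length (filter (ofSize? (suc k)) (map (true ∷_) 𝒮)) + length (filter (ofSize? (suc k)) 𝒮)
      ≡⟨ cong₂ _+_ (trans (cong length (filter-ofSize-true∷ 𝒮 k)) (length-map (true ∷_) (filter (ofSize? k) 𝒮)))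
                   (length-subsetsOfSize n (suc k)) ⟩
    length (filter (ofSize? k) 𝒮) + n C suc k ≡⟨ cong (_+ n C suc k) (length-subsetsOfSize n k) ⟩
    n C k + n C suc k                         ≡⟨ nCk+nC[k+1]≡[n+1]C[k+1] n k ⟩
    suc n C suc k ∎

copies : List B → A → List (A × B)
copies I S = map (S ,_) I

module _ (I : List B) where

  All-copies : ∀ {P : Pred A p} {L} → All P L → All (P ∘ proj₁) (concatMap (copies I) L)
  All-copies [] = []
  All-copies (pS ∷ pL) = AllP.++⁺ (AllP.map⁺ (All.universal (λ _ → pS) I)) (All-copies pL)

  filter-concatMap-copies : ∀ {P : Pred A p} (P? : Decidable P) L →
    filter (P? ∘ proj₁) (concatMap (copies I) L) ≡ concatMap (copies I) (filter P? L)
  filter-concatMap-copies P? [] = refl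
  filter-concatMap-copies P? (S ∷ L) with P? S
  ... | yes pS = trans (filter-++ (P? ∘ proj₁) (copies I S) _)
                       (cong₂ _++_ (filter-all (P? ∘ proj₁) (AllP.map⁺ (All.universal (λ _ → pS) I)))
                                   (filter-concatMap-copies P? L))
  ... | no ¬pS = trans (filter-++ (P? ∘ proj₁) (copies I S) _)
                       (cong₂ _++_ (filter-none (P? ∘ proj₁) (AllP.map⁺ (All.universal (λ _ → ¬pS) I)))
                                   (filter-concatMap-copies P? L))

  concatMap-copies-map : ∀ {C : Set a} (f : A → C) L →
    concatMap (copies I) (map f L) ≡ map (map₁ f) (concatMap (copies I) L)
  concatMap-copies-map f [] = refl
  concatMap-copies-map f (S ∷ L) =
    trans (cong₂ _++_ (map-∘ I) (concatMap-copies-map f L)) (sym (map-++ (map₁ f) (copies I S) _))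

completeEdges-ofSize : ∀ n h λ′ → All (λ e → ∣ proj₁ e ∣ ≡ h) (completeEdges n h λ′)
completeEdges-ofSize n h λ′ = All-copies (allFin λ′) (AllP.all-filter (ofSize? h) (allSubsets n))

module _ {v : ℕ} (x : Fin v) where

  degree-replicated : ∀ S (I : List B) → degree x (map (λ _ → S) I) ≡ length I * bit (lookup S x)
  degree-replicated S [] = refl
  degree-replicated S (i ∷ I) = trans (degree-∷ x S _) (cong (bit (lookup S x) +_) (degree-replicated S I))

  degree-copies : ∀ (I : List B) L → degree x (map proj₁ (concatMap (copies I) L)) ≡ length I * degree x L
  degree-copies I [] = sym (*-zeroʳ (length I))
  degree-copies {B = B} I (S ∷ L) = begin
    degree x (map proj₁ (map (S ,_) I ++ rest))
      ≡⟨ cong (degree x) (map-++ proj₁ (map (S ,_) I) rest) ⟩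
    degree x (map proj₁ (map (S ,_) I) ++ map proj₁ rest)
      ≡⟨ degree-++ x (map proj₁ (map (S ,_) I)) (map proj₁ rest) ⟩
    degree x (map proj₁ (map (S ,_) I)) + degree x (map proj₁ rest)
      ≡⟨ cong₂ _+_ (trans (cong (degree x) (sym (map-∘ I))) (degree-replicated S I)) (degree-copies I L) ⟩
    length I * bit (lookup S x) + length I * degree x L  ≡⟨ *-distribˡ-+ (length I) _ _ ⟨
    length I * (bit (lookup S x) + degree x L)           ≡⟨ cong (length I *_) (degree-∷ x S L) ⟨
    length I * degree x (S ∷ L)                          ∎
    where
    open ≡-Reasoning
    rest : List (Subset v × B)
    rest = concatMap (copies I) L

degree-zero-true∷ : ∀ {v} (L : List (Subset v)) → degree F.zero (map (true ∷_) L) ≡ length L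
degree-zero-true∷ [] = refl
degree-zero-true∷ (S ∷ L) = cong suc (degree-zero-true∷ L)

degree-zero-false∷ : ∀ {v} (L : List (Subset v)) → degree F.zero (map (false ∷_) L) ≡ 0
degree-zero-false∷ [] = refl
degree-zero-false∷ (S ∷ L) = degree-zero-false∷ L

degree-zero-complete : ∀ n h λ′ → degree F.zero (map proj₁ (completeEdges (suc n) (suc h) λ′)) ≡ λ′ * (n C h)
degree-zero-complete n h λ′ = begin
  degree F.zero (map proj₁ (completeEdges (suc n) (suc h) λ′))
    ≡⟨ degree-copies F.zero (allFin λ′) (filter (ofSize? (suc h)) (allSubsets (suc n))) ⟩
  length (allFin λ′) * degree F.zero (filter (ofSize? (suc h)) (map (true ∷_) 𝒮 ++ map (false ∷_) 𝒮))
    ≡⟨ cong₂ _*_ (length-tabulate {n = λ′} id) (cong (degree F.zero) split) ⟩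
  λ′ * degree F.zero (map (true ∷_) smaller ++ map (false ∷_) same)
    ≡⟨ cong (λ′ *_) (degree-++ F.zero (map (true ∷_) smaller) (map (false ∷_) same)) ⟩
  λ′ * (degree F.zero (map (true ∷_) smaller) + degree F.zero (map (false ∷_) same))
    ≡⟨ cong (λ′ *_) (cong₂ _+_ (degree-zero-true∷ smaller) (degree-zero-false∷ same)) ⟩
  λ′ * (length smaller + 0)
    ≡⟨ cong (λ′ *_) (trans (+-identityʳ _) (length-subsetsOfSize n h)) ⟩
  λ′ * (n C h) ∎
  where
  open ≡-Reasoning
  𝒮 smaller same : List (Subset n)
  𝒮 = allSubsets n
  smaller = filter (ofSize? h) 𝒮
  same = filter (ofSize? (suc h)) 𝒮

  split : filter (ofSize? (suc h)) (map (true ∷_) 𝒮 ++ map (false ∷_) 𝒮) ≡ map (true ∷_) smaller ++ map (false ∷_) same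
  split = trans (filter-++ (ofSize? (suc h)) (map (true ∷_) 𝒮) (map (false ∷_) 𝒮))
                (cong₂ _++_ (filter-ofSize-true∷ 𝒮 h) (filter-ofSize-false∷ 𝒮 (suc h)))

module _ {v k λ′ : ℕ} (col : Subset v → Fin λ′ → Fin k) where

  colour? : (j : Fin k) → Decidable (λ (e : Subset v × Fin λ′) → col (proj₁ e) (proj₂ e) ≡ j)
  colour? j e = col (proj₁ e) (proj₂ e) F.≟ j

  ∑-degree-colourClasses : ∀ x L → ∑[ j < k ] degree x (map proj₁ (filter (colour? j) L)) ≡ degree x (map proj₁ L)
  ∑-degree-colourClasses x [] = ∑-vanishing (λ (j : Fin k) → 0) (λ _ → refl)
  ∑-degree-colourClasses x (e@(S , i) ∷ L) = begin
    ∑[ j < k ] degree x (map proj₁ (filter (colour? j) (e ∷ L)))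
      ≡⟨ sum-cong-≗ {x = λ j → degree x (map proj₁ (filter (colour? j) (e ∷ L)))} split ⟩
    ∑[ j < k ] (degree x (classOf e j) + degree x (map proj₁ (filter (colour? j) L)))
      ≡⟨ ∑-distrib-+ (λ j → degree x (classOf e j)) (λ j → degree x (map proj₁ (filter (colour? j) L))) ⟩
    ∑[ j < k ] degree x (classOf e j) + ∑[ j < k ] degree x (map proj₁ (filter (colour? j) L))
      ≡⟨ cong₂ _+_ (∑-supported-at (λ j → degree x (classOf e j)) (col S i) vanishes)
                   (∑-degree-colourClasses x L) ⟩
    degree x (classOf e (col S i)) + degree x (map proj₁ L)
      ≡⟨ cong (λ E → degree x E + degree x (map proj₁ L)) (cong (map proj₁) (filter-accept (colour? (col S i)) refl)) ⟩
    degree x [ S ] + degree x (map proj₁ L)  ≡⟨ degree-++ x [ S ] (map proj₁ L) ⟨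
    degree x (map proj₁ (e ∷ L)) ∎
    where
    open ≡-Reasoning
    classOf : Subset v × Fin λ′ → Fin k → List (Subset v)
    classOf e j = map proj₁ (filter (colour? j) [ e ])

    split : ∀ j → degree x (map proj₁ (filter (colour? j) (e ∷ L)))
                  ≡ degree x (classOf e j) + degree x (map proj₁ (filter (colour? j) L))
    split j = trans (cong (degree x ∘ map proj₁) (filter-++ (colour? j) [ e ] L))
              (trans (cong (degree x) (map-++ proj₁ (filter (colour? j) [ e ]) (filter (colour? j) L)))
                     (degree-++ x (classOf e j) _))

    vanishes : ∀ j → col S i ≢ j → degree x (classOf e j) ≡ 0
    vanishes j ≢j = cong (degree x ∘ map proj₁) (filter-reject (colour? j) ≢j)

handshake-regular : ∀ {v} h r (E : List (Subset v)) → All (λ S → ∣ S ∣ ≡ h) E → IsRFactor r E → h * length E ≡ v * r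
handshake-regular {v} h r E sizes regular =
  trans (sym (∑-degree-uniform h E sizes)) (trans (sum-cong-≗ {x = λ x → degree x E} regular) (∑-const v r))

colorClass-ofSize : ∀ {n h λ′ k} (col : Subset n → Fin λ′ → Fin k) j →
  All (λ S → ∣ S ∣ ≡ h) (colorClass n h λ′ col j)
colorClass-ofSize {n} {h} {λ′} col j = AllP.map⁺ (AllP.filter⁺ (colour? col j) (completeEdges-ofSize n h λ′))

h∣r*v : ∀ {v} h r (E : List (Subset v)) → All (λ S → ∣ S ∣ ≡ h) E → IsRFactor r E → h ∣ r * v
h∣r*v {v} h r E sizes regular =
  divides (length E) (trans (*-comm r v) (trans (sym (handshake-regular h r E sizes regular)) (*-comm h (length E))))

r∣λ*C : ∀ {n h λ′ k r} (col : Subset (suc n) → Fin λ′ → Fin k) →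
  (∀ j → IsRFactor r (colorClass (suc n) (suc h) λ′ col j)) → r ∣ λ′ * (n C h)
r∣λ*C {n} {h} {λ′} {k} {r} col factor = divides k (sym (begin
  k * r
    ≡⟨ ∑-const k r ⟨
  ∑[ j < k ] r
    ≡⟨ sum-cong-≗ {x = λ _ → r} (λ j → sym (factor j F.zero)) ⟩
  ∑[ j < k ] degree F.zero (colorClass (suc n) (suc h) λ′ col j)
    ≡⟨ ∑-degree-colourClasses col F.zero (completeEdges (suc n) (suc h) λ′) ⟩
  degree F.zero (map proj₁ (completeEdges (suc n) (suc h) λ′))
    ≡⟨ degree-zero-complete n h λ′ ⟩
  λ′ * (n C h) ∎))
  where open ≡-Reasoning

-- Hypergraphs on the first m of m + d vertices

pad : ∀ {m} d → Subset m → Subset (m + d)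
pad d S = S ++ᵛ ∅

module _ {m d : ℕ} (S : Subset m) where

  embed≡pad : embed {m} {m + d} S ≡ pad d S
  embed≡pad = trans (sym (tabulate∘lookup (embed S))) (trans (tabulate-cong pointwise) (tabulate∘lookup (pad d S)))
    where
    -- the right-hand side is the with-function in embed's where block, which cannot be named
    unfold : ∀ x → lookup (embed {m} {m + d} S) x ≡ _
    unfold x = lookup∘tabulate _ x

    pointwise : ∀ x → lookup (embed {m} {m + d} S) x ≡ lookup (pad d S) x
    pointwise x rewrite unfold x with toℕ x <? m
    ... | yes x<m = sym (lookup-++-< S ∅ x x<m)
    ... | no x≮m = sym (trans (lookup-++-≥ S ∅ x (≮⇒≥ x≮m)) (lookup-replicate (F.reduce≥ x (≮⇒≥ x≮m)) false))

  lookup-pad-↑ˡ : ∀ a → lookup (pad d S) (a ↑ˡ d) ≡ lookup S a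
  lookup-pad-↑ˡ = lookup-++ˡ S ∅

  lookup-pad-↑ʳ : ∀ i → lookup (pad d S) (m ↑ʳ i) ≡ false
  lookup-pad-↑ʳ i = trans (lookup-++ʳ S ∅ i) (lookup-replicate i false)

∣pad∣ : ∀ {m} d (S : Subset m) → ∣ pad d S ∣ ≡ ∣ S ∣
∣pad∣ d [] = ∣⊥∣≡0 d
∣pad∣ d (true ∷ S) = cong suc (∣pad∣ d S)
∣pad∣ d (false ∷ S) = ∣pad∣ d S

isEmpty : ∀ {d} → Subset d → Bool
isEmpty [] = true
isEmpty (true ∷ _) = false
isEmpty (false ∷ U) = isEmpty U

inside : ∀ m {d} → Subset (m + d) → Bool
inside zero U = isEmpty U
inside (suc m) (_ ∷ U) = inside m U

filter-isEmpty : ∀ d → filterᵇ isEmpty (allSubsets d) ≡ [ ∅ ]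
filter-isEmpty zero = refl
filter-isEmpty (suc d) = begin
  filterᵇ isEmpty (map (true ∷_) 𝒮 ++ map (false ∷_) 𝒮)
    ≡⟨ filter-++ (T? ∘ isEmpty) (map (true ∷_) 𝒮) (map (false ∷_) 𝒮) ⟩
  filterᵇ isEmpty (map (true ∷_) 𝒮) ++ filterᵇ isEmpty (map (false ∷_) 𝒮)
    ≡⟨ cong₂ _++_ (filter-none (T? ∘ isEmpty) (AllP.map⁺ (All.universal (λ _ ()) 𝒮)))
                  (filter-map-comm (T? ∘ isEmpty) (false ∷_) 𝒮) ⟩
  map (false ∷_) (filterᵇ isEmpty 𝒮)  ≡⟨ cong (map (false ∷_)) (filter-isEmpty d) ⟩
  [ ∅ ] ∎
  where
  open ≡-Reasoning
  𝒮 : List (Subset d)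
  𝒮 = allSubsets d

filter-inside : ∀ m d → filterᵇ (inside m) (allSubsets (m + d)) ≡ map (pad d) (allSubsets m)
filter-inside zero d = filter-isEmpty d
filter-inside (suc m) d = begin
  filterᵇ (inside (suc m)) (map (true ∷_) 𝒮 ++ map (false ∷_) 𝒮)
    ≡⟨ filter-++ (T? ∘ inside (suc m)) (map (true ∷_) 𝒮) (map (false ∷_) 𝒮) ⟩
  filterᵇ (inside (suc m)) (map (true ∷_) 𝒮) ++ filterᵇ (inside (suc m)) (map (false ∷_) 𝒮)
    ≡⟨ cong₂ _++_ (prepend true) (prepend false) ⟩
  map (true ∷_) (map (pad d) (allSubsets m)) ++ map (false ∷_) (map (pad d) (allSubsets m))
    ≡⟨ cong₂ _++_ (map-∘ (allSubsets m)) (map-∘ (allSubsets m)) ⟨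
  map (pad d ∘ (true ∷_)) (allSubsets m) ++ map (pad d ∘ (false ∷_)) (allSubsets m)
    ≡⟨ cong₂ _++_ (map-∘ {g = pad d} (allSubsets m)) (map-∘ {g = pad d} (allSubsets m)) ⟩
  map (pad d) (map (true ∷_) (allSubsets m)) ++ map (pad d) (map (false ∷_) (allSubsets m))
    ≡⟨ map-++ (pad d) (map (true ∷_) (allSubsets m)) (map (false ∷_) (allSubsets m)) ⟨
  map (pad d) (allSubsets (suc m)) ∎
  where
  open ≡-Reasoning
  𝒮 : List (Subset (m + d))
  𝒮 = allSubsets (m + d)
  prepend : ∀ b → filterᵇ (inside (suc m)) (map (b ∷_) 𝒮) ≡ map (b ∷_) (map (pad d) (allSubsets m))
  prepend b = trans (filter-map-comm (T? ∘ inside (suc m)) (b ∷_) 𝒮) (cong (map (b ∷_)) (filter-inside m d))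

outside-vertex : ∀ m {d} (U : Subset (m + d)) → ¬ T (inside m U) → ∃ λ i → lookup U (m ↑ʳ i) ≡ true
outside-vertex zero (true ∷ U) _ = F.zero , refl
outside-vertex zero (false ∷ U) notEmpty = Product.map F.suc id (outside-vertex zero U notEmpty)
outside-vertex zero [] notEmpty = contradiction _ notEmpty
outside-vertex (suc m) (_ ∷ U) notInside = outside-vertex m U notInside

module _ {m d h λ′ k : ℕ} (pc : Subset m → Fin λ′ → Fin k) (col : Subset (m + d) → Fin λ′ → Fin k)
         (agree : ∀ S → ∣ S ∣ ≡ h → ∀ i → col (pad d S) i ≡ pc S i) where

  private
    Λ : List (Fin λ′)
    Λ = allFin λ′
    padEdge : Subset m × Fin λ′ → Subset (m + d) × Fin λ′
    padEdge = map₁ (pad d)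

  filter-inside-completeEdges :
    filter (T? ∘ inside m ∘ proj₁) (completeEdges (m + d) h λ′) ≡ map padEdge (completeEdges m h λ′)
  filter-inside-completeEdges = begin
    filter (T? ∘ inside m ∘ proj₁) (concatMap (copies Λ) (filter (ofSize? h) (allSubsets (m + d))))
      ≡⟨ filter-concatMap-copies Λ (T? ∘ inside m) (filter (ofSize? h) (allSubsets (m + d))) ⟩
    concatMap (copies Λ) (filterᵇ (inside m) (filter (ofSize? h) (allSubsets (m + d))))
      ≡⟨ cong (concatMap (copies Λ)) (filter-comm (T? ∘ inside m) (ofSize? h) (allSubsets (m + d))) ⟩
    concatMap (copies Λ) (filter (ofSize? h) (filterᵇ (inside m) (allSubsets (m + d))))
      ≡⟨ cong (concatMap (copies Λ) ∘ filter (ofSize? h)) (filter-inside m d) ⟩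
    concatMap (copies Λ) (filter (ofSize? h) (map (pad d) (allSubsets m)))
      ≡⟨ cong (concatMap (copies Λ)) (filter-map-comm (ofSize? h) (pad d) (allSubsets m)) ⟩
    concatMap (copies Λ) (map (pad d) (filter (ofSize? h ∘ pad d) (allSubsets m)))
      ≡⟨ cong (concatMap (copies Λ) ∘ map (pad d))
              (filter-≐ (ofSize? h ∘ pad d) (ofSize? h)
                        ((λ {S} → trans (sym (∣pad∣ d S))) , (λ {S} → trans (∣pad∣ d S))) (allSubsets m)) ⟩
    concatMap (copies Λ) (map (pad d) (filter (ofSize? h) (allSubsets m)))
      ≡⟨ concatMap-copies-map Λ (pad d) (filter (ofSize? h) (allSubsets m)) ⟩
    map padEdge (completeEdges m h λ′) ∎
    where open ≡-Reasoning

  filter-inside-colorClass : ∀ j →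
    filterᵇ (inside m) (colorClass (m + d) h λ′ col j) ≡ map (pad d) (colorClass m h λ′ pc j)
  filter-inside-colorClass j = begin
    filterᵇ (inside m) (map proj₁ (filter (colour? col j) (completeEdges (m + d) h λ′)))
      ≡⟨ filter-map-comm (T? ∘ inside m) proj₁ (filter (colour? col j) (completeEdges (m + d) h λ′)) ⟩
    map proj₁ (filter (T? ∘ inside m ∘ proj₁) (filter (colour? col j) (completeEdges (m + d) h λ′)))
      ≡⟨ cong (map proj₁) (filter-comm (T? ∘ inside m ∘ proj₁) (colour? col j) (completeEdges (m + d) h λ′)) ⟩
    map proj₁ (filter (colour? col j) (filter (T? ∘ inside m ∘ proj₁) (completeEdges (m + d) h λ′)))
      ≡⟨ cong (map proj₁ ∘ filter (colour? col j)) filter-inside-completeEdges ⟩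
    map proj₁ (filter (colour? col j) (map padEdge (completeEdges m h λ′)))
      ≡⟨ cong (map proj₁) (filter-map-comm (colour? col j) padEdge (completeEdges m h λ′)) ⟩
    map proj₁ (map padEdge (filter (colour? col j ∘ padEdge) (completeEdges m h λ′)))
      ≡⟨ cong (map proj₁ ∘ map padEdge)
              (filter-cong-All (colour? col j ∘ padEdge) (colour? pc j) (All.map agreeing (completeEdges-ofSize m h λ′))) ⟩
    map proj₁ (map padEdge (filter (colour? pc j) (completeEdges m h λ′)))
      ≡⟨ map-∘ (filter (colour? pc j) (completeEdges m h λ′)) ⟨
    map (pad d ∘ proj₁) (filter (colour? pc j) (completeEdges m h λ′))
      ≡⟨ map-∘ (filter (colour? pc j) (completeEdges m h λ′)) ⟩
    map (pad d) (colorClass m h λ′ pc j) ∎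
    where
    open ≡-Reasoning
    agreeing : ∀ {e} → ∣ proj₁ e ∣ ≡ h →
      (col (pad d (proj₁ e)) (proj₂ e) ≡ j) ⇔ (pc (proj₁ e) (proj₂ e) ≡ j)
    agreeing {S , i} ∣S∣≡h = mk⇔ (trans (sym (agree S ∣S∣≡h i))) (trans (agree S ∣S∣≡h i))

vertex-view : ∀ m {d} (y : Fin (m + d)) → (∃ λ a → a ↑ˡ d ≡ y) ⊎ (∃ λ i → m ↑ʳ i ≡ y)
vertex-view m y with splitAt m y in eq
... | inj₁ a = inj₁ (a , Finₚ.splitAt⁻¹-↑ˡ eq)
... | inj₂ i = inj₂ (i , Finₚ.splitAt⁻¹-↑ʳ eq)

↑ˡ≢↑ʳ : ∀ {m d} (a : Fin m) (i : Fin d) → a ↑ˡ d ≢ m ↑ʳ i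
↑ˡ≢↑ʳ {m} {d} a i eq with trans (sym (Finₚ.splitAt-↑ˡ m a d)) (trans (cong (splitAt m) eq) (Finₚ.splitAt-↑ʳ m d i))
... | ()

module _ {m d : ℕ} where

  ∈-pad-↑ˡ⁻ : ∀ {T : Subset m} {a} → a ↑ˡ d ∈ pad d T → a ∈ T
  ∈-pad-↑ˡ⁻ {T} {a} a∈ = lookup⇒[]= a T (trans (sym (lookup-pad-↑ˡ T a)) ([]=⇒lookup a∈))

  ∈-pad-↑ˡ⁺ : ∀ {T : Subset m} {a} → a ∈ T → a ↑ˡ d ∈ pad d T
  ∈-pad-↑ˡ⁺ {T} {a} a∈T = lookup⇒[]= (a ↑ˡ d) (pad d T) (trans (lookup-pad-↑ˡ T a) ([]=⇒lookup a∈T))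

  ∉-pad-↑ʳ : ∀ {T : Subset m} {i} → ¬ (m ↑ʳ i ∈ pad d T)
  ∉-pad-↑ʳ {T} {i} i∈ with trans (sym ([]=⇒lookup i∈)) (lookup-pad-↑ʳ T i)
  ... | ()

  degree-pad-↑ˡ : ∀ (E : List (Subset m)) a → degree (a ↑ˡ d) (map (pad d) E) ≡ degree a E
  degree-pad-↑ˡ [] a = refl
  degree-pad-↑ˡ (T ∷ E) a = trans (degree-∷ (a ↑ˡ d) (pad d T) (map (pad d) E))
    (trans (cong₂ _+_ (cong bit (lookup-pad-↑ˡ T a)) (degree-pad-↑ˡ E a)) (sym (degree-∷ a T E)))

  module _ {E : List (Subset m)} where

    Adj-pad⁺ : ∀ {a b} → Adj E a b → Adj (map (pad d) E) (a ↑ˡ d) (b ↑ˡ d)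
    Adj-pad⁺ = AnyP.map⁺ ∘ Any.map (Product.map ∈-pad-↑ˡ⁺ ∈-pad-↑ˡ⁺)

    Adj-pad⁻ : ∀ {a b} → Adj (map (pad d) E) (a ↑ˡ d) (b ↑ˡ d) → Adj E a b
    Adj-pad⁻ = Any.map (Product.map ∈-pad-↑ˡ⁻ ∈-pad-↑ˡ⁻) ∘ AnyP.map⁻

    ¬Adj-pad-↑ʳˡ : ∀ {i y} → ¬ Adj (map (pad d) E) (m ↑ʳ i) y
    ¬Adj-pad-↑ʳˡ = ∉-pad-↑ʳ ∘ proj₁ ∘ proj₂ ∘ Any.satisfied ∘ AnyP.map⁻

    ¬Adj-pad-↑ʳʳ : ∀ {i y} → ¬ Adj (map (pad d) E) y (m ↑ʳ i)
    ¬Adj-pad-↑ʳʳ = ∉-pad-↑ʳ ∘ proj₂ ∘ proj₂ ∘ Any.satisfied ∘ AnyP.map⁻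

    Linked-pad⁺ : ∀ {a b} → Linked E a b → Linked (map (pad d) E) (a ↑ˡ d) (b ↑ˡ d)
    Linked-pad⁺ = Star.gmap (_↑ˡ d) Adj-pad⁺

NumComponents-pad : ∀ {m} d {E : List (Subset m)} {c} → NumComponents E c → NumComponents (map (pad d) E) (c + d)
NumComponents-pad {m} d {E} {c} (f , surjective , linked⇔) = f′ , surjective′ , linked⇔′
  where
  f′ : Fin (m + d) → Fin (c + d)
  f′ y = [ (λ a → f a ↑ˡ d) , c ↑ʳ_ ]′ (splitAt m y)

  f′-↑ˡ : ∀ a → f′ (a ↑ˡ d) ≡ f a ↑ˡ d
  f′-↑ˡ a = cong [ (λ a → f a ↑ˡ d) , c ↑ʳ_ ]′ (Finₚ.splitAt-↑ˡ m a d)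

  f′-↑ʳ : ∀ i → f′ (m ↑ʳ i) ≡ c ↑ʳ i
  f′-↑ʳ i = cong [ (λ a → f a ↑ˡ d) , c ↑ʳ_ ]′ (Finₚ.splitAt-↑ʳ m d i)

  surjective′ : Surjective _≡_ _≡_ f′
  surjective′ t with vertex-view c t
  ... | inj₁ (l , refl) = proj₁ (surjective l) ↑ˡ d ,
                          λ { refl → trans (f′-↑ˡ _) (cong (_↑ˡ d) (proj₂ (surjective l) refl)) }
  ... | inj₂ (i , refl) = m ↑ʳ i , λ { refl → f′-↑ʳ i }

  adjacent : ∀ {y z} → Adj (map (pad d) E) y z → f′ y ≡ f′ z
  adjacent {y} {z} adj with vertex-view m y | vertex-view m z
  ... | inj₁ (a , refl) | inj₁ (b , refl) =
    trans (f′-↑ˡ a) (trans (cong (_↑ˡ d) (proj₂ (linked⇔ a b) (Adj-pad⁻ adj ◅ ε))) (sym (f′-↑ˡ b)))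
  ... | inj₂ (_ , refl) | _ = contradiction adj ¬Adj-pad-↑ʳˡ
  ... | inj₁ _ | inj₂ (_ , refl) = contradiction adj ¬Adj-pad-↑ʳʳ

  sound : ∀ y z → f′ y ≡ f′ z → Linked (map (pad d) E) y z
  sound y z with vertex-view m y | vertex-view m z
  ... | inj₁ (a , refl) | inj₁ (b , refl) = λ eq →
    Linked-pad⁺ (proj₁ (linked⇔ a b)
      (Finₚ.↑ˡ-injective d (f a) (f b) (trans (sym (f′-↑ˡ a)) (trans eq (f′-↑ˡ b)))))
  ... | inj₂ (i , refl) | inj₂ (i′ , refl) = λ eq →
    subst (Linked (map (pad d) E) (m ↑ʳ i) ∘ (m ↑ʳ_))
          (Finₚ.↑ʳ-injective c i i′ (trans (sym (f′-↑ʳ i)) (trans eq (f′-↑ʳ i′)))) ε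
  ... | inj₁ (a , refl) | inj₂ (i , refl) = λ eq →
    contradiction (trans (sym (f′-↑ˡ a)) (trans eq (f′-↑ʳ i))) (↑ˡ≢↑ʳ (f a) i)
  ... | inj₂ (i , refl) | inj₁ (a , refl) = λ eq →
    contradiction (trans (sym (f′-↑ˡ a)) (trans (sym eq) (f′-↑ʳ i))) (↑ˡ≢↑ʳ (f a) i)

  linked⇔′ : ∀ y z → (f′ y ≡ f′ z → Linked (map (pad d) E) y z) × (Linked (map (pad d) E) y z → f′ y ≡ f′ z)
  linked⇔′ y z = sound y z , Star.fold (λ y z → f′ y ≡ f′ z) (trans ∘ adjacent) refl

-- Extending a partial r-factorization

lower-bound-arith : ∀ h r m d g x → h * (g + x) ≡ (m + d) * r → x ≤ d * r →
  h * r * m + r * (m + d) ≤ h * g + h * r * (m + d)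
lower-bound-arith h r m d g x handshake x≤dr = begin
  h * r * m + r * (m + d)      ≡⟨ cong (h * r * m +_) (trans (*-comm r (m + d)) (sym handshake)) ⟩
  h * r * m + h * (g + x)      ≡⟨ regroup h r m g x ⟩
  h * g + h * r * m + h * x    ≤⟨ +-monoʳ-≤ (h * g + h * r * m) (*-monoʳ-≤ h x≤dr) ⟩
  h * g + h * r * m + h * (d * r) ≡⟨ collect h r m d g ⟩
  h * g + h * r * (m + d)      ∎
  where
  open ≤-Reasoning
  regroup : ∀ h r m g x → h * r * m + h * (g + x) ≡ h * g + h * r * m + h * x
  regroup = solve-∀
  collect : ∀ h r m d g → h * g + h * r * m + h * (d * r) ≡ h * g + h * r * (m + d)
  collect = solve-∀

upper-bound-arith : ∀ h′ h r n g x y → h * (g + x) ≡ n * r → y ≤ h′ * x → h′ * h * g + h * y ≤ h′ * r * n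
upper-bound-arith h′ h r n g x y handshake y≤h′x = begin
  h′ * h * g + h * y            ≤⟨ +-monoʳ-≤ (h′ * h * g) (*-monoʳ-≤ h y≤h′x) ⟩
  h′ * h * g + h * (h′ * x)     ≡⟨ factor h′ h g x ⟩
  h′ * (h * (g + x))            ≡⟨ cong (h′ *_) handshake ⟩
  h′ * (n * r)                  ≡⟨ reorder h′ n r ⟩
  h′ * r * n                    ∎
  where
  open ≤-Reasoning
  factor : ∀ h′ h g x → h′ * h * g + h * (h′ * x) ≡ h′ * (h * (g + x))
  factor = solve-∀
  reorder : ∀ h′ n r → h′ * (n * r) ≡ h′ * r * n
  reorder = solve-∀

module Extension {m d h r λ′ k : ℕ} (pc : Subset m → Fin λ′ → Fin k) (col : Subset (m + d) → Fin λ′ → Fin k)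
  (agree : ∀ S → ∣ S ∣ ≡ h → ∀ i → col (pad d S) i ≡ pc S i)
  (factor : ∀ j → IsRFactor r (colorClass (m + d) h λ′ col j) × IsConnected (colorClass (m + d) h λ′ col j)) where

  F : Fin k → List (Subset (m + d))
  F = colorClass (m + d) h λ′ col

  G : Fin k → List (Subset m)
  G = colorClass m h λ′ pc

  inside? : Decidable (λ (S : Subset (m + d)) → T (inside m S))
  inside? = T? ∘ inside m

  crossing : Fin k → List (Subset (m + d))
  crossing j = filter (¬? ∘ inside?) (F j)

  inner≡padded : ∀ j → filter inside? (F j) ≡ map (pad d) (G j)
  inner≡padded = filter-inside-colorClass pc col agree

  degree-↑ˡ-split : ∀ j a → degree (a ↑ˡ d) (F j) ≡ degree a (G j) + degree (a ↑ˡ d) (crossing j)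
  degree-↑ˡ-split j a = trans (degree-filter-split inside? (a ↑ˡ d) (F j))
    (cong (_+ degree (a ↑ˡ d) (crossing j)) (trans (cong (degree (a ↑ˡ d)) (inner≡padded j)) (degree-pad-↑ˡ (G j) a)))

  handshake : ∀ j → h * (length (G j) + length (crossing j)) ≡ (m + d) * r
  handshake j = begin
    h * (length (G j) + length (crossing j))
      ≡⟨ cong (λ g → h * (g + length (crossing j))) (trans (cong length (inner≡padded j)) (length-map (pad d) (G j))) ⟨
    h * (length (filter inside? (F j)) + length (crossing j)) ≡⟨ cong (h *_) (length-filter-split inside? (F j)) ⟨
    h * length (F j) ≡⟨ handshake-regular h r (F j) (colorClass-ofSize col j) (proj₁ (factor j)) ⟩
    (m + d) * r ∎
    where open ≡-Reasoning

  crossing-bound : ∀ j → length (crossing j) ≤ d * r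
  crossing-bound j = begin
    length (crossing j)                          ≤⟨ length≤∑-degree (m ↑ʳ_) (crossing j) meets-outside ⟩
    ∑[ i < d ] degree (m ↑ʳ i) (crossing j)      ≤⟨ ∑-mono {d} (λ i → m≤n+m _ _) ⟩
    ∑[ i < d ] (degree (m ↑ʳ i) (filter inside? (F j)) + degree (m ↑ʳ i) (crossing j))
      ≡⟨ sum-cong-≗ {x = λ i → degree (m ↑ʳ i) (filter inside? (F j)) + degree (m ↑ʳ i) (crossing j)}
                    (λ i → trans (sym (degree-filter-split inside? (m ↑ʳ i) (F j))) (proj₁ (factor j) (m ↑ʳ i))) ⟩
    ∑[ i < d ] r                                 ≡⟨ ∑-const d r ⟩
    d * r                                        ∎
    where
    open ≤-Reasoning
    meets-outside : All (λ S → ∃ λ i → lookup S (m ↑ʳ i) ≡ true) (crossing j)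
    meets-outside = All.map (outside-vertex m _) (AllP.all-filter (¬? ∘ inside?) (F j))

  lower-bound : ∀ j → h * r * m + r * (m + d) ≤ h * length (G j) + h * r * (m + d)
  lower-bound j = lower-bound-arith h r m d (length (G j)) (length (crossing j)) (handshake j) (crossing-bound j)

  upper-bound : ∀ j {c} → NumComponents (G j) c →
    (h ∸ 1) * h * length (G j) + h * (d + c ∸ 1) ≤ (h ∸ 1) * r * (m + d)
  upper-bound j {c} components = upper-bound-arith (h ∸ 1) h r (m + d) (length (G j)) (length (crossing j)) (d + c ∸ 1)
    (handshake j) (m≤n+o⇒m∸n≤o (d + c) 1 (subst (_≤ suc ((h ∸ 1) * length (crossing j))) (+-comm c d) c+d≤))
    where
    connected : IsConnected (map (pad d) (G j) ++ crossing j)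
    connected x y = subst (λ E → Linked (E ++ crossing j) x y) (inner≡padded j)
                      (linked-filter-split inside? (proj₂ (factor j) x y))

    c+d≤ : c + d ≤ suc ((h ∸ 1) * length (crossing j))
    c+d≤ = numComponents≤ (h ∸ 1) (map (pad d) (G j)) (crossing j) (NumComponents-pad d components) connected
             (All.map (λ ∣S∣≡h → ≤-trans (≤-reflexive ∣S∣≡h) (m≤n+m∸n h 1))
                      (AllP.filter⁺ (¬? ∘ inside?) (colorClass-ofSize col j)))

  no-regular-component : Fin d → ∀ j x → ¬ ComponentRRegular r (G j) x
  no-regular-component o j x regular = ↑ˡ≢↑ʳ (proj₁ outside-reached) o (proj₁ (proj₂ outside-reached))
    where
    Reached : Fin (m + d) → Set
    Reached y = ∃ λ a → a ↑ˡ d ≡ y × Linked (G j) x a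

    no-crossing : ∀ {a} → Linked (G j) x a → degree (a ↑ˡ d) (crossing j) ≡ 0
    no-crossing {a} x~a = +-cancelˡ-≡ r _ _ (begin
      r + degree (a ↑ˡ d) (crossing j)         ≡⟨ cong (_+ degree (a ↑ˡ d) (crossing j)) (regular a x~a) ⟨
      degree a (G j) + degree (a ↑ˡ d) (crossing j) ≡⟨ degree-↑ˡ-split j a ⟨
      degree (a ↑ˡ d) (F j)                    ≡⟨ proj₁ (factor j) (a ↑ˡ d) ⟩
      r                                        ≡⟨ +-identityʳ r ⟨
      r + 0                                    ∎)
      where open ≡-Reasoning

    step : ∀ {y z} → Adj (F j) y z → Reached y → Reached z
    step {z = z} adj (a , refl , x~a) with Any-filter-split inside? adj
    ... | inj₂ crossingAdj = contradiction (no-crossing x~a) (n>0⇒n≢0 (degree-pos (Any.map proj₁ crossingAdj)))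
    ... | inj₁ innerAdj with subst (λ E → Adj E (a ↑ˡ d) z) (inner≡padded j) innerAdj | vertex-view m z
    ...   | paddedAdj | inj₁ (b , refl) = b , refl , x~a ◅◅ (Adj-pad⁻ paddedAdj ◅ ε)
    ...   | paddedAdj | inj₂ (i , refl) = contradiction paddedAdj ¬Adj-pad-↑ʳʳ

    outside-reached : Reached (m ↑ʳ o)
    outside-reached = Star.fold (λ y z → Reached y → Reached z) (λ adj go → go ∘ step adj) id
                        (proj₂ (factor j) (x ↑ˡ d) (m ↑ʳ o)) (x , refl , ε)

lemma7p3 : (n m h r λ' : ℕ) → .{{_ : NonZero r}} → 1 ≤ λ' → m < n → h < m → 2 ≤ h →
    let k = (λ' * ((n ∸ 1) C (h ∸ 1))) / r in
    (pc : Subset m → Fin λ' → Fin k) →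
    ((j : Fin k) (x : Fin m) → degree x (colorClass m h λ' pc j) ≤ r) →
    (col : Subset n → Fin λ' → Fin k) →
    ((S : Subset m) → ∣ S ∣ ≡ h → (i : Fin λ') → col (embed S) i ≡ pc S i) →
    ((j : Fin k) → IsRFactor r (colorClass n h λ' col j) × IsConnected (colorClass n h λ' col j)) →
    ((h ∣ r * n) × (r ∣ λ' * ((n ∸ 1) C (h ∸ 1))))
    × ((j : Fin k) (x : Fin m) → ¬ ComponentRRegular r (colorClass m h λ' pc j) x)
    × ((j : Fin k) (c : ℕ) → NumComponents (colorClass m h λ' pc j) c →
        (h * r * m + r * n ≤ h * length (colorClass m h λ' pc j) + h * r * n)
        × ((h ∸ 1) * h * length (colorClass m h λ' pc j) + h * ((n ∸ m) + c ∸ 1) ≤ (h ∸ 1) * r * n))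
lemma7p3 n (suc m′) (suc h′) r (suc λ″) _ m<n _ _ pc _ col agree factor
  with m≤n⇒∃[o]m+o≡n (<⇒≤ m<n)
... | zero , refl = contradiction m<n (<-irrefl (sym (+-identityʳ (suc m′))))
... | suc d′ , refl =
  admissible , no-regular-component F.zero , λ j c components →
    lower-bound j , subst (λ t → h′ * suc h′ * length (G j) + suc h′ * (t + c ∸ 1) ≤ h′ * r * n)
                          (sym (m+n∸m≡n (suc m′) (suc d′))) (upper-bound j components)
  where
  agree-pad : ∀ S → ∣ S ∣ ≡ suc h′ → ∀ i → col (pad (suc d′) S) i ≡ pc S i
  agree-pad S ∣S∣≡h i = trans (cong (λ U → col U i) (sym (embed≡pad S))) (agree S ∣S∣≡h i)

  open Extension pc col agree-pad factor

  admissible : (suc h′ ∣ r * n) × (r ∣ suc λ″ * ((m′ + suc d′) C h′))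
  admissible =
    -- any colour class will do, and λ ≥ 1 lets us name one
    let j = col ∅ F.zero in
    h∣r*v (suc h′) r (F j) (colorClass-ofSize col j) (proj₁ (factor j)) , r∣λ*C col (proj₁ ∘ factor)
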